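{- For every integer $n\ge1$, \[ \sum_{\substack{m+k=n\\ m\ge 1,\ k\ge 0}}q_\psi(m)\sum_{j\ge0}\omega(k-jm)=\begin{cases}-\omega(n)&\text{if } n \text{ is odd},\\ -\omega(n)+\omega(n/2)&\text{if } n \text{ is even},\end{cases} \] where $q_\psi(m)$ is the number of partitions of $m$ into distinct parts whose greatest common divisor is $1$.
   Context: For integers $m$, $\omega(m)=1$ if $m=0$; $\omega(m)=(-1)^i$ if $m=\frac{3i^2\pm i}{2}$ for some positive integer $i$; $\omega(m)=0$ otherwise (in particular for $m<0$). -}

module Defs where

open import Data.Nat as ℕ using (ℕ; zero; suc; _≟_)
open import Data.Nat.GCD using (gcd)
open import Data.Integer as ℤ using (ℤ; +_; -[1+_])
open import Data.List using (List; []; _∷_; map; upTo; length; filter; foldr; _++_)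
open import Data.Nat.ListAction using (sum)
open import Data.Bool using (Bool; if_then_else_; _∨_)
open import Relation.Nullary using (does)
open import Relation.Nullary.Decidable using (_×-dec_)

-- ω on natural numbers: ω 0 = 1; ω m = (-1)^i if m = (3i²+i)/2 or m = (3i²-i)/2
-- for some i ≥ 1 (such i is unique and satisfies i ≤ m); 0 otherwise.
-- The condition m = (3i² - i)/2 is tested as 2m + i = 3i² (avoiding truncated subtraction).
isPent : ℕ → ℕ → Bool
isPent m i = does (2 ℕ.* m ≟ 3 ℕ.* i ℕ.* i ℕ.+ i) ∨ does (2 ℕ.* m ℕ.+ i ≟ 3 ℕ.* i ℕ.* i)

firstPent : ℕ → List ℕ → ℤ
firstPent m [] = + 0
firstPent m (i ∷ is) = if isPent m i then (ℤ.- (+ 1)) ℤ.^ i else firstPent m is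

ωℕ : ℕ → ℤ
ωℕ zero = + 1
ωℕ m@(suc _) = firstPent m (map suc (upTo m))

ω : ℤ → ℤ
ω (+ m) = ωℕ m
ω -[1+ _ ] = + 0

sublists : List ℕ → List (List ℕ)
sublists [] = [] ∷ []
sublists (x ∷ xs) = let r = sublists xs in map (x ∷_) r ++ r

gcdList : List ℕ → ℕ
gcdList = foldr gcd 0

-- q_ψ(m): number of partitions of m into distinct parts with gcd 1,
-- i.e. number of subsets S ⊆ {1,…,m} with Σ S = m and gcd S = 1.
qψ : ℕ → ℕ
qψ m = length (filter (λ s → (sum s ≟ m) ×-dec (gcdList s ≟ 1)) (sublists (map suc (upTo m))))

-- Σ_{j ≥ 0} ω(k - j m); for m ≥ 1 and j > k the argument is negative, so j ∈ {0,…,k} suffices.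
innerSum : ℕ → ℕ → ℤ
innerSum m k = foldr ℤ._+_ (+ 0) (map (λ j → ω (+ k ℤ.- + (j ℕ.* m))) (upTo (suc k)))

lhs : ℕ → ℤ
lhs n = foldr ℤ._+_ (+ 0) (map (λ i → let m = suc i in + qψ m ℤ.* innerSum m (n ℕ.∸ m)) (upTo n))

{-# OPTIONS --safe #-}

-- Let E(x) = ∏ᵢ (1 - xⁱ) and D(x) = ∏ᵢ (1 + xⁱ), so that E(x) D(x) = E(x²). By the pentagonal
-- number theorem E(x) = Σₜ ω(t) xᵗ, and sorting the distinct partitions of N ≥ 1 by the gcd d of
-- their parts gives D(x) = 1 + Σ_{d,m ≥ 1} q_ψ(m) x^{dm}. In the coefficient of xⁿ in E(x) D(x)
-- the constant term of D contributes ω(n) and the rest contributes exactly the left-hand side,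
-- while the coefficient of xⁿ in E(x²) is ω(n/2) for even n and 0 for odd n.
--
-- All products are truncated at i ≤ n and act on coefficient sequences. The pentagonal number
-- theorem comes from Shanks' finite identity
--   Σ_{k ≤ m} (-1)ᵏ x^{mk + k(k+1)/2} ∏_{k < i ≤ m} (1 - xⁱ) = Σ_{|j| ≤ m} (-1)ʲ x^{j(3j+1)/2},
-- proved by induction on m: passing from m to m + 1 the summands telescope.

module Submission where

open import Defs
open import Data.Bool using (Bool; true; false; T; if_then_else_; _∧_; _∨_)
open import Data.Bool.Properties using (T-∧; T-∨)
open import Data.Empty using (⊥; ⊥-elim)
open import Data.Integer as ℤ using (ℤ; +_; 0ℤ; 1ℤ; -1ℤ; _+_; _*_; -_; _-_; _^_)
import Data.Integer.Properties as ℤP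
open import Data.Integer.Tactic.RingSolver using (solve-∀)
open import Data.List using (List; []; _∷_; _++_; [_]; map; filter; length; foldr; upTo; applyUpTo)
import Data.List.Properties as LP
open import Data.List.Relation.Unary.All as All using (All; []; _∷_)
open import Data.Nat as ℕ using (ℕ; zero; suc; z≤n; s≤s; _≤_; _<_; _∸_; _≟_; _<?_; _≤?_)
open import Data.Nat.Divisibility using (_∣_; _∣?_; divides; ∣-trans; ∣m∣n⇒∣m+n; 0∣⇒≡0; ∣⇒≤; m∣m*n)
open import Data.Nat.GCD using (gcd; gcd[m,n]∣m; gcd[m,n]∣n; c*gcd[m,n]≡gcd[cm,cn])
open import Data.Nat.ListAction using (sum)
import Data.Nat.Properties as ℕP
import Data.Nat.Tactic.RingSolver as ℕSolver
open import Data.Product using (∃; _×_; _,_; proj₁; proj₂)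
open import Data.Sum using (_⊎_; inj₁; inj₂)
open import Function using (_∘_; _⇔_; mk⇔; Equivalence)
open import Relation.Binary using (tri<; tri≈; tri>)
open import Relation.Binary.PropositionalEquality hiding ([_])
open import Relation.Nullary using (¬_; yes; no; does)
open import Relation.Nullary.Decidable using (dec-true; dec-false; does-⇔; _×-dec_)
open import Relation.Unary using (Decidable)

-- Finite sums

∑< : ℕ → (ℕ → ℤ) → ℤ
∑< zero    f = 0ℤ
∑< (suc n) f = ∑< n f + f n

infix 5 ∑<
syntax ∑< n (λ i → e) = ∑[ i < n ] e

∑-cong : ∀ n {f g : ℕ → ℤ} → (∀ i → i < n → f i ≡ g i) → ∑< n f ≡ ∑< n g
∑-cong zero    eq = refl
∑-cong (suc n) eq = cong₂ _+_ (∑-cong n (λ i i<n → eq i (ℕP.m<n⇒m<1+n i<n))) (eq n ℕP.≤-refl)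

∑-zero : ∀ n {f : ℕ → ℤ} → (∀ i → i < n → f i ≡ 0ℤ) → ∑< n f ≡ 0ℤ
∑-zero n eq = trans (∑-cong n eq) (zeros n)
  where
  zeros : ∀ n → ∑[ _ < n ] 0ℤ ≡ 0ℤ
  zeros zero    = refl
  zeros (suc n) = cong (_+ 0ℤ) (zeros n)

∑-distrib-+ : ∀ n (f g : ℕ → ℤ) → ∑[ i < n ] f i + g i ≡ ∑< n f + ∑< n g
∑-distrib-+ zero    f g = refl
∑-distrib-+ (suc n) f g = begin
  (∑[ i < n ] f i + g i) + (f n + g n)  ≡⟨ cong (_+ (f n + g n)) (∑-distrib-+ n f g) ⟩
  ∑< n f + ∑< n g + (f n + g n)          ≡⟨ interchange (∑< n f) (∑< n g) (f n) (g n) ⟩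
  ∑< n f + f n + (∑< n g + g n)          ∎
  where
  open ≡-Reasoning
  interchange : ∀ a b c d → a + b + (c + d) ≡ a + c + (b + d)
  interchange = solve-∀

∑-*ˡ : ∀ n (c : ℤ) (f : ℕ → ℤ) → ∑[ i < n ] c * f i ≡ c * ∑< n f
∑-*ˡ zero    c f = sym (ℤP.*-zeroʳ c)
∑-*ˡ (suc n) c f = trans (cong (_+ c * f n) (∑-*ˡ n c f)) (sym (ℤP.*-distribˡ-+ c (∑< n f) (f n)))

∑-sucˡ : ∀ n (f : ℕ → ℤ) → ∑< (suc n) f ≡ f 0 + ∑< n (f ∘ suc)
∑-sucˡ zero    f = ℤP.+-comm 0ℤ (f 0)
∑-sucˡ (suc n) f = trans (cong (_+ f (suc n)) (∑-sucˡ n f)) (ℤP.+-assoc (f 0) _ _)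

∑-+ : ∀ a b (f : ℕ → ℤ) → ∑< (a ℕ.+ b) f ≡ ∑< a f + (∑[ i < b ] f (a ℕ.+ i))
∑-+ a zero    f = trans (cong (λ n → ∑< n f) (ℕP.+-identityʳ a)) (sym (ℤP.+-identityʳ (∑< a f)))
∑-+ a (suc b) f rewrite ℕP.+-suc a b = trans (cong (_+ f (a ℕ.+ b)) (∑-+ a b f)) (ℤP.+-assoc (∑< a f) _ _)

∑-truncate : ∀ n k (f : ℕ → ℤ) → (∀ i → i < k → f (n ℕ.+ i) ≡ 0ℤ) → ∑< (n ℕ.+ k) f ≡ ∑< n f
∑-truncate n k f tail≡0 = begin
  ∑< (n ℕ.+ k) f                      ≡⟨ ∑-+ n k f ⟩
  ∑< n f + (∑[ i < k ] f (n ℕ.+ i))   ≡⟨ cong (_+_ (∑< n f)) (∑-zero k tail≡0) ⟩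
  ∑< n f + 0ℤ                         ≡⟨ ℤP.+-identityʳ (∑< n f) ⟩
  ∑< n f                              ∎
  where open ≡-Reasoning

∑-swap : ∀ n m (f : ℕ → ℕ → ℤ) → ∑[ i < n ] ∑[ j < m ] f i j ≡ ∑[ j < m ] ∑[ i < n ] f i j
∑-swap zero    m f = sym (∑-zero m (λ _ _ → refl))
∑-swap (suc n) m f = trans (cong (_+ (∑[ j < m ] f n j)) (∑-swap n m f))
                           (sym (∑-distrib-+ m (λ j → ∑[ i < n ] f i j) (f n)))

∑-single : ∀ n i₀ (f : ℕ → ℤ) → i₀ < n → (∀ i → i < n → i ≢ i₀ → f i ≡ 0ℤ) → ∑< n f ≡ f i₀
∑-single (suc n) i₀ f i₀<1+n others with i₀ ≟ n
... | yes refl = trans (cong (_+ f i₀) (∑-zero n (λ i i<n → others i (ℕP.m<n⇒m<1+n i<n) (ℕP.<⇒≢ i<n))))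
                       (ℤP.+-identityˡ (f i₀))
... | no i₀≢n  = begin
  ∑< n f + f n   ≡⟨ cong₂ _+_ (∑-single n i₀ f i₀<n (λ i i<n → others i (ℕP.m<n⇒m<1+n i<n)))
                              (others n ℕP.≤-refl (i₀≢n ∘ sym)) ⟩
  f i₀ + 0ℤ      ≡⟨ ℤP.+-identityʳ (f i₀) ⟩
  f i₀           ∎
  where
  open ≡-Reasoning
  i₀<n : i₀ < n
  i₀<n = ℕP.≤∧≢⇒< (ℕP.≤-pred i₀<1+n) i₀≢n

∑-telescope : ∀ n (a g : ℕ → ℤ) → ∑[ k < n ] a k - g k + g (suc k) ≡ ∑< n a - g 0 + g n
∑-telescope zero    a g = sym (cancel (g 0))
  where
  cancel : ∀ x → 0ℤ - x + x ≡ 0ℤ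
  cancel = solve-∀
∑-telescope (suc n) a g = trans (cong (_+ (a n - g n + g (suc n))) (∑-telescope n a g))
                                (regroup (∑< n a) (g 0) (g n) (a n) (g (suc n)))
  where
  regroup : ∀ s g₀ gₙ aₙ g₁₊ₙ → s - g₀ + gₙ + (aₙ - gₙ + g₁₊ₙ) ≡ s + aₙ - g₀ + g₁₊ₙ
  regroup = solve-∀

-- Power series and the factors 1 + c xᵃ

Series : Set
Series = ℕ → ℤ

one : Series
one zero    = 1ℤ
one (suc _) = 0ℤ

⟦_⟧ : Bool → ℤ
⟦ true  ⟧ = 1ℤ
⟦ false ⟧ = 0ℤ

shift : ℕ → Series → Series
shift zero    f t       = f t
shift (suc a) f zero    = 0ℤ
shift (suc a) f (suc t) = shift a f t

mulFactor : ℤ → ℕ → Series → Series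
mulFactor c a f t = f t + c * shift a f t

mulFactors : ℤ → List ℕ → Series → Series
mulFactors c []       f = f
mulFactors c (a ∷ as) f = mulFactor c a (mulFactors c as f)

shift-cong : ∀ a {f g : Series} → f ≗ g → shift a f ≗ shift a g
shift-cong zero    f≗g t       = f≗g t
shift-cong (suc a) f≗g zero    = refl
shift-cong (suc a) f≗g (suc t) = shift-cong a f≗g t

shift-linear : ∀ a c (f g : Series) t →
  shift a (λ u → f u + c * g u) t ≡ shift a f t + c * shift a g t
shift-linear zero    c f g t       = refl
shift-linear (suc a) c f g zero    = sym (cong (_+_ 0ℤ) (ℤP.*-zeroʳ c))
shift-linear (suc a) c f g (suc t) = shift-linear a c f g t

shift-+ : ∀ a b (f : Series) t → shift a (shift b f) t ≡ shift (a ℕ.+ b) f t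
shift-+ zero    b f t       = refl
shift-+ (suc a) b f zero    = refl
shift-+ (suc a) b f (suc t) = shift-+ a b f t

shift-comm : ∀ a b (f : Series) t → shift a (shift b f) t ≡ shift b (shift a f) t
shift-comm a b f t = begin
  shift a (shift b f) t   ≡⟨ shift-+ a b f t ⟩
  shift (a ℕ.+ b) f t     ≡⟨ cong (λ s → shift s f t) (ℕP.+-comm a b) ⟩
  shift (b ℕ.+ a) f t     ≡⟨ shift-+ b a f t ⟨
  shift b (shift a f) t   ∎
  where open ≡-Reasoning

shift-< : ∀ a (f : Series) t → t < a → shift a f t ≡ 0ℤ
shift-< (suc a) f zero    _         = refl
shift-< (suc a) f (suc t) (s≤s t<a) = shift-< a f t t<a

shift-+ˡ : ∀ a (f : Series) t → shift a f (a ℕ.+ t) ≡ f t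
shift-+ˡ zero    f t = refl
shift-+ˡ (suc a) f t = shift-+ˡ a f t

shift-one : ∀ a t → shift a one t ≡ ⟦ does (t ≟ a) ⟧
shift-one zero    zero    = refl
shift-one zero    (suc t) = refl
shift-one (suc a) zero    = refl
shift-one (suc a) (suc t) = shift-one a t

mulFactor-cong : ∀ c a {f g : Series} → f ≗ g → mulFactor c a f ≗ mulFactor c a g
mulFactor-cong c a f≗g t = cong₂ (λ x y → x + c * y) (f≗g t) (shift-cong a f≗g t)

mulFactors-cong : ∀ c as {f g : Series} → f ≗ g → mulFactors c as f ≗ mulFactors c as g
mulFactors-cong c []       f≗g = f≗g
mulFactors-cong c (a ∷ as) f≗g = mulFactor-cong c a (mulFactors-cong c as f≗g)

mulFactor-comm : ∀ c a d b (f : Series) →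
  mulFactor c a (mulFactor d b f) ≗ mulFactor d b (mulFactor c a f)
mulFactor-comm c a d b f t
  rewrite shift-linear a d f (shift b f) t | shift-linear b c f (shift a f) t | shift-comm a b f t
  = swap (f t) (shift b f t) (shift a f t) (shift b (shift a f) t) c d
  where
  swap : ∀ x y z w c d → x + d * y + c * (z + d * w) ≡ x + c * z + d * (y + c * w)
  swap = solve-∀

mulFactor-mulFactors : ∀ c a d bs (f : Series) →
  mulFactor c a (mulFactors d bs f) ≗ mulFactors d bs (mulFactor c a f)
mulFactor-mulFactors c a d []       f t = refl
mulFactor-mulFactors c a d (b ∷ bs) f t =
  trans (mulFactor-comm c a d b (mulFactors d bs f) t) (mulFactor-cong d b (mulFactor-mulFactors c a d bs f) t)

mulFactors-∷ʳ : ∀ c as b (f : Series) → mulFactors c (as ++ [ b ]) f ≗ mulFactor c b (mulFactors c as f)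
mulFactors-∷ʳ c []       b f t = refl
mulFactors-∷ʳ c (a ∷ as) b f t =
  trans (mulFactor-cong c a (mulFactors-∷ʳ c as b f) t) (mulFactor-comm c a c b (mulFactors c as f) t)

range : ℕ → ℕ → List ℕ
range a zero    = []
range a (suc k) = suc a ∷ range (suc a) k

range-∷ʳ : ∀ a k → range a (suc k) ≡ range a k ++ [ suc (a ℕ.+ k) ]
range-∷ʳ a zero    = cong (λ b → [ suc b ]) (sym (ℕP.+-identityʳ a))
range-∷ʳ a (suc k) = cong (suc a ∷_) (trans (range-∷ʳ (suc a) k)
                                             (cong (λ b → range (suc a) k ++ [ suc b ]) (sym (ℕP.+-suc a k))))

-- The pentagonal number theorem, in Shanks' finite form

eulerProduct : ℕ → Series
eulerProduct n = mulFactors -1ℤ (range 0 n) one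

tailProduct : ℕ → ℕ → Series
tailProduct m k = mulFactors -1ℤ (range k (m ∸ k)) one

triangle : ℕ → ℕ
triangle zero    = 0
triangle (suc k) = triangle k ℕ.+ suc k

shanksExponent : ℕ → ℕ → ℕ
shanksExponent m k = m ℕ.* k ℕ.+ triangle k

sign : ℕ → ℤ
sign k = -1ℤ ^ k

shanksTerm : ℕ → ℕ → Series
shanksTerm m k = shift (shanksExponent m k) (tailProduct m k)

shanksSum : ℕ → Series
shanksSum m t = ∑[ k < suc m ] sign k * shanksTerm m k t

telescopingTerm : ℕ → ℕ → Series
telescopingTerm m zero    t = 0ℤ
telescopingTerm m (suc k)   = shift (shanksExponent m (suc k)) (tailProduct m k)

pentagonalPair : ℕ → Series
pentagonalPair j t =
  sign (suc j) * (shift (shanksExponent j (suc j)) one t + shift (shanksExponent (suc j) (suc j)) one t)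

tailProduct-∷ʳ : ∀ m k → k ≤ m → tailProduct (suc m) k ≗ mulFactor -1ℤ (suc m) (tailProduct m k)
tailProduct-∷ʳ m k k≤m t =
  trans (cong (λ as → mulFactors -1ℤ as one t) factors)
        (mulFactors-∷ʳ -1ℤ (range k (m ∸ k)) (suc m) one t)
  where
  factors : range k (suc m ∸ k) ≡ range k (m ∸ k) ++ [ suc m ]
  factors = begin
    range k (suc m ∸ k)                          ≡⟨ cong (range k) (ℕP.+-∸-assoc 1 k≤m) ⟩
    range k (suc (m ∸ k))                        ≡⟨ range-∷ʳ k (m ∸ k) ⟩
    range k (m ∸ k) ++ [ suc (k ℕ.+ (m ∸ k)) ]
      ≡⟨ cong (λ b → range k (m ∸ k) ++ [ suc b ]) (ℕP.m+[n∸m]≡n k≤m) ⟩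
    range k (m ∸ k) ++ [ suc m ]                 ∎
    where open ≡-Reasoning

tailProduct-∷ : ∀ m k → k < m → tailProduct m k ≗ mulFactor -1ℤ (suc k) (tailProduct m (suc k))
tailProduct-∷ (suc m) k (s≤s k≤m) t = cong (λ l → mulFactors -1ℤ (range k l) one t) (ℕP.+-∸-assoc 1 k≤m)

tailProduct-diag : ∀ m → tailProduct m m ≗ one
tailProduct-diag m t rewrite ℕP.n∸n≡0 m = refl

shanksExponent-sucˡ : ∀ m k → shanksExponent (suc m) k ≡ k ℕ.+ shanksExponent m k
shanksExponent-sucˡ m k = ℕP.+-assoc k (m ℕ.* k) (triangle k)

shanksExponent-sucʳ : ∀ m k → shanksExponent (suc m) k ℕ.+ suc m ≡ shanksExponent m (suc k)
shanksExponent-sucʳ m k = regroup m k (triangle k)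
  where
  regroup : ∀ m k x → k ℕ.+ m ℕ.* k ℕ.+ x ℕ.+ suc m ≡ m ℕ.* suc k ℕ.+ (x ℕ.+ suc k)
  regroup = ℕSolver.solve-∀

m<shanksExponent : ∀ m k → m < shanksExponent m (suc k)
m<shanksExponent m k = ℕP.≤-trans (ℕP.≤-reflexive (ℕP.+-comm 1 m))
  (ℕP.+-mono-≤ (ℕP.m≤m*n m (suc k)) (ℕP.≤-trans (s≤s z≤n) (ℕP.m≤n+m (suc k) (triangle k))))

shanksTerm-suc : ∀ m k t → k ≤ m →
  shanksTerm (suc m) k t ≡ shift k (shanksTerm m k) t - telescopingTerm m (suc k) t
shanksTerm-suc m k t k≤m = begin
  shift E (tailProduct (suc m) k) t
    ≡⟨ shift-cong E (tailProduct-∷ʳ m k k≤m) t ⟩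
  shift E (mulFactor -1ℤ (suc m) P) t
    ≡⟨ shift-linear E -1ℤ P (shift (suc m) P) t ⟩
  shift E P t + -1ℤ * shift E (shift (suc m) P) t
    ≡⟨ cong₂ (λ a b → a + -1ℤ * b)
         (trans (cong (λ s → shift s P t) (shanksExponent-sucˡ m k)) (sym (shift-+ k (shanksExponent m k) P t)))
         (trans (shift-+ E (suc m) P t) (cong (λ s → shift s P t) (shanksExponent-sucʳ m k))) ⟩
  shift k (shanksTerm m k) t + -1ℤ * telescopingTerm m (suc k) t
    ≡⟨ cong (_+_ (shift k (shanksTerm m k) t)) (ℤP.-1*i≡-i (telescopingTerm m (suc k) t)) ⟩
  shift k (shanksTerm m k) t - telescopingTerm m (suc k) t
    ∎
  where
  open ≡-Reasoning
  E : ℕ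
  E = shanksExponent (suc m) k
  P : Series
  P = tailProduct m k

shift-shanksTerm : ∀ m k t → k < m →
  shift (suc k) (shanksTerm m (suc k)) t ≡ shanksTerm m (suc k) t - telescopingTerm m (suc k) t
shift-shanksTerm m k t k<m = begin
  shift (suc k) (shift E P) t
    ≡⟨ shift-comm (suc k) E P t ⟩
  shift E (shift (suc k) P) t
    ≡⟨ rearrange (shift E P t) (shift E (shift (suc k) P) t) ⟩
  shift E P t - (shift E P t + -1ℤ * shift E (shift (suc k) P) t)
    ≡⟨ cong (_-_ (shift E P t)) (sym (shift-linear E -1ℤ P (shift (suc k) P) t)) ⟩
  shift E P t - shift E (mulFactor -1ℤ (suc k) P) t
    ≡⟨ cong (_-_ (shift E P t)) (sym (shift-cong E (tailProduct-∷ m k k<m) t)) ⟩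
  shift E P t - shift E (tailProduct m k) t
    ∎
  where
  open ≡-Reasoning
  E : ℕ
  E = shanksExponent m (suc k)
  P : Series
  P = tailProduct m (suc k)
  rearrange : ∀ a b → b ≡ a - (a + -1ℤ * b)
  rearrange = solve-∀

shanksTerm-telescopes : ∀ m k t → k ≤ m →
  sign k * shanksTerm (suc m) k t
    ≡ sign k * shanksTerm m k t - sign k * telescopingTerm m k t + sign (suc k) * telescopingTerm m (suc k) t
shanksTerm-telescopes m zero t _ rewrite shanksTerm-suc m zero t z≤n =
  rearrange (shanksTerm m 0 t) (telescopingTerm m 1 t)
  where
  rearrange : ∀ q r → 1ℤ * (q - r) ≡ 1ℤ * q - 1ℤ * 0ℤ + (-1ℤ * 1ℤ) * r
  rearrange = solve-∀
shanksTerm-telescopes m (suc k) t k<m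
  rewrite shanksTerm-suc m (suc k) t k<m | shift-shanksTerm m k t k<m =
  rearrange (sign k) (shanksTerm m (suc k) t) (telescopingTerm m (suc k) t) (telescopingTerm m (suc (suc k)) t)
  where
  rearrange : ∀ s q r r′ →
    (-1ℤ * s) * (q - r - r′) ≡ (-1ℤ * s) * q - (-1ℤ * s) * r + (-1ℤ * (-1ℤ * s)) * r′
  rearrange = solve-∀

shanksSum-suc : ∀ m t → shanksSum (suc m) t ≡ shanksSum m t + pentagonalPair m t
shanksSum-suc m t = begin
  (∑[ k < suc m ] sign k * shanksTerm (suc m) k t) + sign (suc m) * shanksTerm (suc m) (suc m) t
    ≡⟨ cong (_+ sign (suc m) * shanksTerm (suc m) (suc m) t)
         (trans (∑-cong (suc m) (λ k k<1+m → shanksTerm-telescopes m k t (ℕP.≤-pred k<1+m)))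
                (∑-telescope (suc m) (λ k → sign k * shanksTerm m k t)
                                     (λ k → sign k * telescopingTerm m k t))) ⟩
  shanksSum m t - 1ℤ * 0ℤ + sign (suc m) * shift (shanksExponent m (suc m)) (tailProduct m m) t
    + sign (suc m) * shift (shanksExponent (suc m) (suc m)) (tailProduct (suc m) (suc m)) t
    ≡⟨ cong₂ (λ a b → shanksSum m t - 1ℤ * 0ℤ + sign (suc m) * a + sign (suc m) * b)
         (shift-cong (shanksExponent m (suc m)) (tailProduct-diag m) t)
         (shift-cong (shanksExponent (suc m) (suc m)) (tailProduct-diag (suc m)) t) ⟩
  shanksSum m t - 1ℤ * 0ℤ + sign (suc m) * a + sign (suc m) * b
    ≡⟨ collect (shanksSum m t) (sign (suc m)) a b ⟩
  shanksSum m t + pentagonalPair m t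
    ∎
  where
  open ≡-Reasoning
  a b : ℤ
  a = shift (shanksExponent m (suc m)) one t
  b = shift (shanksExponent (suc m) (suc m)) one t
  collect : ∀ x s a b → x - 1ℤ * 0ℤ + s * a + s * b ≡ x + s * (a + b)
  collect = solve-∀

shanksSum-pentagonal : ∀ m t → shanksSum m t ≡ one t + (∑[ j < m ] pentagonalPair j t)
shanksSum-pentagonal zero    t = unit (one t)
  where
  unit : ∀ x → 0ℤ + 1ℤ * x ≡ x + 0ℤ
  unit = solve-∀
shanksSum-pentagonal (suc m) t rewrite shanksSum-suc m t | shanksSum-pentagonal m t = ℤP.+-assoc (one t) _ _

shanksSum-≤ : ∀ m t → t ≤ m → shanksSum m t ≡ eulerProduct m t
shanksSum-≤ m t t≤m = begin
  ∑[ k < suc m ] sign k * shanksTerm m k t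
    ≡⟨ ∑-sucˡ m (λ k → sign k * shanksTerm m k t) ⟩
  1ℤ * shanksTerm m 0 t + (∑[ k < m ] sign (suc k) * shanksTerm m (suc k) t)
    ≡⟨ cong₂ _+_ (ℤP.*-identityˡ (shanksTerm m 0 t)) (∑-zero m (λ k _ → vanishes k)) ⟩
  shanksTerm m 0 t + 0ℤ
    ≡⟨ ℤP.+-identityʳ (shanksTerm m 0 t) ⟩
  shanksTerm m 0 t
    ≡⟨ cong (λ e → shift e (eulerProduct m) t) (trans (ℕP.+-identityʳ (m ℕ.* 0)) (ℕP.*-zeroʳ m)) ⟩
  eulerProduct m t
    ∎
  where
  open ≡-Reasoning
  vanishes : ∀ k → sign (suc k) * shanksTerm m (suc k) t ≡ 0ℤ
  vanishes k = trans (cong (sign (suc k) *_) (shift-< (shanksExponent m (suc k)) (tailProduct m (suc k)) t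
                                                    (ℕP.≤-<-trans t≤m (m<shanksExponent m k))))
                     (ℤP.*-zeroʳ (sign (suc k)))

eulerProduct-pentagonal : ∀ n t → t ≤ n → eulerProduct n t ≡ one t + (∑[ j < n ] pentagonalPair j t)
eulerProduct-pentagonal n t t≤n = trans (sym (shanksSum-≤ n t t≤n)) (shanksSum-pentagonal n t)

pentagonalValue : ℕ → ℕ → ℤ
pentagonalValue t i = if isPent t i then sign i else 0ℤ

isPent-sound : ∀ t i → T (isPent t i) →
  2 ℕ.* t ≡ 3 ℕ.* i ℕ.* i ℕ.+ i ⊎ 2 ℕ.* t ℕ.+ i ≡ 3 ℕ.* i ℕ.* i
isPent-sound t i p with Equivalence.to (T-∨ {2 ℕ.* t ℕ.≡ᵇ 3 ℕ.* i ℕ.* i ℕ.+ i}) p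
... | inj₁ q = inj₁ (ℕP.≡ᵇ⇒≡ _ _ q)
... | inj₂ q = inj₂ (ℕP.≡ᵇ⇒≡ _ _ q)

isPent-upper : ∀ t i → T (isPent t i) → 2 ℕ.* t ≤ 3 ℕ.* i ℕ.* i ℕ.+ i
isPent-upper t i p with isPent-sound t i p
... | inj₁ eq = ℕP.≤-reflexive eq
... | inj₂ eq = ℕP.≤-trans (ℕP.m≤m+n (2 ℕ.* t) i) (ℕP.≤-trans (ℕP.≤-reflexive eq) (ℕP.m≤m+n _ i))

isPent-lower : ∀ t i → T (isPent t i) → 3 ℕ.* i ℕ.* i ≤ 2 ℕ.* t ℕ.+ i
isPent-lower t i p with isPent-sound t i p
... | inj₁ eq = ℕP.≤-trans (ℕP.m≤m+n _ i) (ℕP.≤-trans (ℕP.≤-reflexive (sym eq)) (ℕP.m≤m+n (2 ℕ.* t) i))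
... | inj₂ eq = ℕP.≤-reflexive (sym eq)

isPent-ordered : ∀ t {i j} → i < j → T (isPent t i) → T (isPent t j) → ⊥
isPent-ordered t {i} {j} i<j p q with ℕP.m≤n⇒∃[o]m+o≡n i<j
... | d , refl = ℕP.<-irrefl refl (begin-strict
  3 ℕ.* j ℕ.* j                          ≤⟨ isPent-lower t j q ⟩
  2 ℕ.* t ℕ.+ j                          ≤⟨ ℕP.+-monoˡ-≤ j (isPent-upper t i p) ⟩
  3 ℕ.* i ℕ.* i ℕ.+ i ℕ.+ j              <⟨ s≤s (ℕP.m≤m+n _ _) ⟩
  suc (3 ℕ.* i ℕ.* i ℕ.+ i ℕ.+ j ℕ.+ _)  ≡⟨ gap i d ⟨
  3 ℕ.* j ℕ.* j                          ∎)
  where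
  open ℕP.≤-Reasoning
  gap : ∀ i d → 3 ℕ.* (suc i ℕ.+ d) ℕ.* (suc i ℕ.+ d)
              ≡ suc (3 ℕ.* i ℕ.* i ℕ.+ i ℕ.+ (suc i ℕ.+ d)
                     ℕ.+ (4 ℕ.* i ℕ.+ 6 ℕ.* i ℕ.* d ℕ.+ 3 ℕ.* d ℕ.* d ℕ.+ 5 ℕ.* d ℕ.+ 1))
  gap = ℕSolver.solve-∀

isPent-unique : ∀ t i j → T (isPent t i) → T (isPent t j) → i ≡ j
isPent-unique t i j p q with ℕP.<-cmp i j
... | tri< i<j _ _ = ⊥-elim (isPent-ordered t i<j p q)
... | tri≈ _ i≡j _ = i≡j
... | tri> _ _ j<i = ⊥-elim (isPent-ordered t j<i q p)

firstPent-∑ : ∀ t k (h : ℕ → ℕ) → (∀ x y → h x ≡ h y → x ≡ y) →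
  firstPent t (applyUpTo h k) ≡ ∑[ j < k ] pentagonalValue t (h j)
firstPent-∑ t zero    h h-injective = refl
firstPent-∑ t (suc k) h h-injective with isPent t (h 0) in isPent₀
... | true  = sym (begin
  ∑[ j < suc k ] pentagonalValue t (h j)
    ≡⟨ ∑-sucˡ k (pentagonalValue t ∘ h) ⟩
  pentagonalValue t (h 0) + (∑[ j < k ] pentagonalValue t (h (suc j)))
    ≡⟨ cong (_+_ (pentagonalValue t (h 0))) (∑-zero k (λ j _ → others j)) ⟩
  pentagonalValue t (h 0) + 0ℤ
    ≡⟨ ℤP.+-identityʳ _ ⟩
  pentagonalValue t (h 0)
    ≡⟨ cong (λ b → if b then sign (h 0) else 0ℤ) isPent₀ ⟩
  sign (h 0)
    ∎)
  where
  open ≡-Reasoning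
  others : ∀ j → pentagonalValue t (h (suc j)) ≡ 0ℤ
  others j with isPent t (h (suc j)) in isPentⱼ
  ... | false = refl
  ... | true with h-injective (suc j) 0
                    (isPent-unique t _ _ (subst T (sym isPentⱼ) _) (subst T (sym isPent₀) _))
  ...   | ()
... | false = begin
  firstPent t (applyUpTo (h ∘ suc) k)
    ≡⟨ firstPent-∑ t k (h ∘ suc) (λ x y → ℕP.suc-injective ∘ h-injective (suc x) (suc y)) ⟩
  ∑[ j < k ] pentagonalValue t (h (suc j))
    ≡⟨ ℤP.+-identityˡ _ ⟨
  0ℤ + (∑[ j < k ] pentagonalValue t (h (suc j)))
    ≡⟨ cong (λ b → (if b then sign (h 0) else 0ℤ) + (∑[ j < k ] pentagonalValue t (h (suc j)))) isPent₀ ⟨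
  pentagonalValue t (h 0) + (∑[ j < k ] pentagonalValue t (h (suc j)))
    ≡⟨ ∑-sucˡ k (pentagonalValue t ∘ h) ⟨
  ∑[ j < suc k ] pentagonalValue t (h j)
    ∎
  where open ≡-Reasoning

triangle-double : ∀ k → 2 ℕ.* triangle k ≡ k ℕ.* suc k
triangle-double zero    = refl
triangle-double (suc k) = begin
  2 ℕ.* (triangle k ℕ.+ suc k)           ≡⟨ ℕP.*-distribˡ-+ 2 (triangle k) (suc k) ⟩
  2 ℕ.* triangle k ℕ.+ 2 ℕ.* suc k       ≡⟨ cong (ℕ._+ 2 ℕ.* suc k) (triangle-double k) ⟩
  k ℕ.* suc k ℕ.+ 2 ℕ.* suc k            ≡⟨ expand k ⟩
  suc k ℕ.* suc (suc k)                  ∎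
  where
  open ≡-Reasoning
  expand : ∀ k → k ℕ.* suc k ℕ.+ 2 ℕ.* suc k ≡ suc k ℕ.* suc (suc k)
  expand = ℕSolver.solve-∀

shanksExponent-diag : ∀ i → 2 ℕ.* shanksExponent i i ≡ 3 ℕ.* i ℕ.* i ℕ.+ i
shanksExponent-diag i = begin
  2 ℕ.* (i ℕ.* i ℕ.+ triangle i)         ≡⟨ ℕP.*-distribˡ-+ 2 (i ℕ.* i) (triangle i) ⟩
  2 ℕ.* (i ℕ.* i) ℕ.+ 2 ℕ.* triangle i   ≡⟨ cong (2 ℕ.* (i ℕ.* i) ℕ.+_) (triangle-double i) ⟩
  2 ℕ.* (i ℕ.* i) ℕ.+ i ℕ.* suc i        ≡⟨ expand i ⟩
  3 ℕ.* i ℕ.* i ℕ.+ i                    ∎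
  where
  open ≡-Reasoning
  expand : ∀ i → 2 ℕ.* (i ℕ.* i) ℕ.+ i ℕ.* suc i ≡ 3 ℕ.* i ℕ.* i ℕ.+ i
  expand = ℕSolver.solve-∀

shanksExponent-subdiag : ∀ j → 2 ℕ.* shanksExponent j (suc j) ℕ.+ suc j ≡ 3 ℕ.* suc j ℕ.* suc j
shanksExponent-subdiag j = begin
  2 ℕ.* (j ℕ.* suc j ℕ.+ triangle (suc j)) ℕ.+ suc j
    ≡⟨ cong (ℕ._+ suc j) (ℕP.*-distribˡ-+ 2 (j ℕ.* suc j) (triangle (suc j))) ⟩
  2 ℕ.* (j ℕ.* suc j) ℕ.+ 2 ℕ.* triangle (suc j) ℕ.+ suc j
    ≡⟨ cong (λ x → 2 ℕ.* (j ℕ.* suc j) ℕ.+ x ℕ.+ suc j) (triangle-double (suc j)) ⟩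
  2 ℕ.* (j ℕ.* suc j) ℕ.+ suc j ℕ.* suc (suc j) ℕ.+ suc j
    ≡⟨ expand j ⟩
  3 ℕ.* suc j ℕ.* suc j
    ∎
  where
  open ≡-Reasoning
  expand : ∀ j → 2 ℕ.* (j ℕ.* suc j) ℕ.+ suc j ℕ.* suc (suc j) ℕ.+ suc j ≡ 3 ℕ.* suc j ℕ.* suc j
  expand = ℕSolver.solve-∀

⟦⟧+⟦⟧-disjoint : ∀ s b₁ b₂ → (T b₁ → T b₂ → ⊥) →
  s * (⟦ b₁ ⟧ + ⟦ b₂ ⟧) ≡ (if b₂ ∨ b₁ then s else 0ℤ)
⟦⟧+⟦⟧-disjoint s true  true  disjoint = ⊥-elim (disjoint _ _)
⟦⟧+⟦⟧-disjoint s true  false _        = ℤP.*-identityʳ s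
⟦⟧+⟦⟧-disjoint s false true  _        = ℤP.*-identityʳ s
⟦⟧+⟦⟧-disjoint s false false _        = ℤP.*-zeroʳ s

pentagonalPair-value : ∀ j t → pentagonalPair j t ≡ pentagonalValue t (suc j)
pentagonalPair-value j t = begin
  sign i * (shift e₁ one t + shift e₂ one t)
    ≡⟨ cong₂ (λ x y → sign i * (x + y)) (shift-one e₁ t) (shift-one e₂ t) ⟩
  sign i * (⟦ does (t ≟ e₁) ⟧ + ⟦ does (t ≟ e₂) ⟧)
    ≡⟨ ⟦⟧+⟦⟧-disjoint (sign i) (does (t ≟ e₁)) (does (t ≟ e₂)) distinct ⟩
  (if does (t ≟ e₂) ∨ does (t ≟ e₁) then sign i else 0ℤ)
    ≡⟨ cong₂ (λ b₂ b₁ → if b₂ ∨ b₁ then sign i else 0ℤ)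
         (does-⇔ on₂ (t ≟ e₂) (2 ℕ.* t ≟ 3 ℕ.* i ℕ.* i ℕ.+ i))
         (does-⇔ on₁ (t ≟ e₁) (2 ℕ.* t ℕ.+ i ≟ 3 ℕ.* i ℕ.* i)) ⟩
  pentagonalValue t i
    ∎
  where
  open ≡-Reasoning
  i e₁ e₂ : ℕ
  i  = suc j
  e₁ = shanksExponent j i
  e₂ = shanksExponent i i
  distinct : T (does (t ≟ e₁)) → T (does (t ≟ e₂)) → ⊥
  distinct p q = ℕP.m≢1+n+m e₁ {j}
    (trans (sym (ℕP.≡ᵇ⇒≡ t e₁ p)) (trans (ℕP.≡ᵇ⇒≡ t e₂ q) (shanksExponent-sucˡ j i)))
  on₁ : t ≡ e₁ ⇔ 2 ℕ.* t ℕ.+ i ≡ 3 ℕ.* i ℕ.* i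
  on₁ = mk⇔ (λ t≡e₁ → trans (cong (λ x → 2 ℕ.* x ℕ.+ i) t≡e₁) (shanksExponent-subdiag j))
            (λ eq → ℕP.*-cancelˡ-≡ t e₁ 2 (ℕP.+-cancelʳ-≡ i _ _ (trans eq (sym (shanksExponent-subdiag j)))))
  on₂ : t ≡ e₂ ⇔ 2 ℕ.* t ≡ 3 ℕ.* i ℕ.* i ℕ.+ i
  on₂ = mk⇔ (λ t≡e₂ → trans (cong (2 ℕ.*_) t≡e₂) (shanksExponent-diag i))
            (λ eq → ℕP.*-cancelˡ-≡ t e₂ 2 (trans eq (sym (shanksExponent-diag i))))

pentagonalPair-≤ : ∀ j t → t ≤ j → pentagonalPair j t ≡ 0ℤ
pentagonalPair-≤ j t t≤j
  rewrite shift-< (shanksExponent j (suc j)) one t (ℕP.≤-<-trans t≤j (m<shanksExponent j j))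
        | shift-< (shanksExponent (suc j) (suc j)) one t
                  (ℕP.≤-<-trans t≤j (ℕP.<-trans (ℕP.n<1+n j) (m<shanksExponent (suc j) j)))
  = ℤP.*-zeroʳ (sign (suc j))

eulerProduct-ω : ∀ n t → t ≤ n → eulerProduct n t ≡ ωℕ t
eulerProduct-ω n zero    _   = begin
  eulerProduct n 0                         ≡⟨ eulerProduct-pentagonal n 0 z≤n ⟩
  1ℤ + (∑[ j < n ] pentagonalPair j 0)     ≡⟨ cong (_+_ 1ℤ) (∑-zero n (λ j _ → pentagonalPair-≤ j 0 z≤n)) ⟩
  1ℤ + 0ℤ                                  ≡⟨⟩
  ωℕ 0                                     ∎
  where open ≡-Reasoning
eulerProduct-ω n (suc t) t<n = begin
  eulerProduct n (suc t)
    ≡⟨ eulerProduct-pentagonal n (suc t) t<n ⟩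
  0ℤ + (∑[ j < n ] pentagonalPair j (suc t))
    ≡⟨ ℤP.+-identityˡ _ ⟩
  ∑[ j < n ] pentagonalPair j (suc t)
    ≡⟨ cong (λ k → ∑[ j < k ] pentagonalPair j (suc t)) (ℕP.m+[n∸m]≡n t<n) ⟨
  ∑[ j < suc t ℕ.+ (n ∸ suc t) ] pentagonalPair j (suc t)
    ≡⟨ ∑-truncate (suc t) (n ∸ suc t) (λ j → pentagonalPair j (suc t))
                  (λ j _ → pentagonalPair-≤ (suc t ℕ.+ j) (suc t) (ℕP.m≤m+n (suc t) j)) ⟩
  ∑[ j < suc t ] pentagonalPair j (suc t)
    ≡⟨ ∑-cong (suc t) (λ j _ → pentagonalPair-value j (suc t)) ⟩
  ∑[ j < suc t ] pentagonalValue (suc t) (suc j)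
    ≡⟨ firstPent-∑ (suc t) (suc t) suc (λ _ _ → ℕP.suc-injective) ⟨
  firstPent (suc t) (applyUpTo suc (suc t))
    ≡⟨ cong (firstPent (suc t)) (LP.map-upTo suc (suc t)) ⟨
  ωℕ (suc t)
    ∎
  where open ≡-Reasoning

-- Convolution and the identity ∏ (1 - xᵃ) ∏ (1 + xᵃ) = ∏ (1 - x²ᵃ)

infixl 7 _⋆_
_⋆_ : Series → Series → Series
(f ⋆ g) n = ∑[ k < suc n ] f (n ∸ k) * g k

⋆-linearʳ : ∀ f g c h n → (f ⋆ (λ u → g u + c * h u)) n ≡ (f ⋆ g) n + c * (f ⋆ h) n
⋆-linearʳ f g c h n = begin
  ∑[ k < suc n ] f (n ∸ k) * (g k + c * h k)
    ≡⟨ ∑-cong (suc n) (λ k _ → distribute (f (n ∸ k)) (g k) c (h k)) ⟩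
  ∑[ k < suc n ] f (n ∸ k) * g k + c * (f (n ∸ k) * h k)
    ≡⟨ ∑-distrib-+ (suc n) (λ k → f (n ∸ k) * g k) (λ k → c * (f (n ∸ k) * h k)) ⟩
  (f ⋆ g) n + (∑[ k < suc n ] c * (f (n ∸ k) * h k))
    ≡⟨ cong (_+_ ((f ⋆ g) n)) (∑-*ˡ (suc n) c (λ k → f (n ∸ k) * h k)) ⟩
  (f ⋆ g) n + c * (f ⋆ h) n
    ∎
  where
  open ≡-Reasoning
  distribute : ∀ a b c d → a * (b + c * d) ≡ a * b + c * (a * d)
  distribute = solve-∀

⋆-shift-+ : ∀ f g a v → (f ⋆ shift a g) (a ℕ.+ v) ≡ (f ⋆ g) v
⋆-shift-+ f g a v = begin
  ∑[ k < suc (a ℕ.+ v) ] f (a ℕ.+ v ∸ k) * shift a g k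
    ≡⟨ cong (λ l → ∑[ k < l ] f (a ℕ.+ v ∸ k) * shift a g k) (ℕP.+-suc a v) ⟨
  ∑[ k < a ℕ.+ suc v ] f (a ℕ.+ v ∸ k) * shift a g k
    ≡⟨ ∑-+ a (suc v) _ ⟩
  (∑[ k < a ] f (a ℕ.+ v ∸ k) * shift a g k)
    + (∑[ k < suc v ] f (a ℕ.+ v ∸ (a ℕ.+ k)) * shift a g (a ℕ.+ k))
    ≡⟨ cong₂ _+_ (∑-zero a (λ k k<a → trans (cong (f (a ℕ.+ v ∸ k) *_) (shift-< a g k k<a))
                                            (ℤP.*-zeroʳ (f (a ℕ.+ v ∸ k)))))
                 (∑-cong (suc v) (λ k _ → cong₂ _*_ (cong f (ℕP.[m+n]∸[m+o]≡n∸o a v k)) (shift-+ˡ a g k))) ⟩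
  0ℤ + (f ⋆ g) v
    ≡⟨ ℤP.+-identityˡ _ ⟩
  (f ⋆ g) v
    ∎
  where open ≡-Reasoning

⋆-shift : ∀ f g a → f ⋆ shift a g ≗ shift a (f ⋆ g)
⋆-shift f g a n with n <? a
... | yes n<a = trans (∑-zero (suc n) (λ k k≤n → trans (cong (f (n ∸ k) *_) (shift-< a g k (ℕP.<-≤-trans k≤n n<a)))
                                                   (ℤP.*-zeroʳ (f (n ∸ k)))))
                      (sym (shift-< a (f ⋆ g) n n<a))
... | no n≮a with ℕP.m≤n⇒∃[o]m+o≡n (ℕP.≮⇒≥ n≮a)
... | v , refl = trans (⋆-shift-+ f g a v) (sym (shift-+ˡ a (f ⋆ g) v))

⋆-one : ∀ f → f ⋆ one ≗ f
⋆-one f n = begin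
  (f ⋆ one) n
    ≡⟨ ∑-sucˡ n (λ k → f (n ∸ k) * one k) ⟩
  f n * 1ℤ + (∑[ k < n ] f (n ∸ suc k) * 0ℤ)
    ≡⟨ cong₂ _+_ (ℤP.*-identityʳ (f n)) (∑-zero n (λ k _ → ℤP.*-zeroʳ (f (n ∸ suc k)))) ⟩
  f n + 0ℤ
    ≡⟨ ℤP.+-identityʳ (f n) ⟩
  f n
    ∎
  where open ≡-Reasoning

⋆-mulFactor : ∀ f c a g → f ⋆ mulFactor c a g ≗ mulFactor c a (f ⋆ g)
⋆-mulFactor f c a g n =
  trans (⋆-linearʳ f g c (shift a g) n) (cong (λ x → (f ⋆ g) n + c * x) (⋆-shift f g a n))

⋆-mulFactors : ∀ f c as g → f ⋆ mulFactors c as g ≗ mulFactors c as (f ⋆ g)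
⋆-mulFactors f c []       g n = refl
⋆-mulFactors f c (a ∷ as) g n =
  trans (⋆-mulFactor f c a (mulFactors c as g) n) (mulFactor-cong c a (⋆-mulFactors f c as g) n)

mulFactor-conjugate : ∀ a f → mulFactor 1ℤ a (mulFactor -1ℤ a f) ≗ mulFactor -1ℤ (a ℕ.+ a) f
mulFactor-conjugate a f t rewrite shift-linear a -1ℤ f (shift a f) t | shift-+ a a f t =
  cancel (f t) (shift a f t) (shift (a ℕ.+ a) f t)
  where
  cancel : ∀ x y z → x + -1ℤ * y + 1ℤ * (y + -1ℤ * z) ≡ x + -1ℤ * z
  cancel = solve-∀

mulFactors-conjugate : ∀ as f →
  mulFactors 1ℤ as (mulFactors -1ℤ as f) ≗ mulFactors -1ℤ (map (λ a → a ℕ.+ a) as) f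
mulFactors-conjugate []       f t = refl
mulFactors-conjugate (a ∷ as) f t = begin
  mulFactor 1ℤ a (mulFactors 1ℤ as (mulFactor -1ℤ a (mulFactors -1ℤ as f))) t
    ≡⟨ mulFactor-cong 1ℤ a (λ u → sym (mulFactor-mulFactors -1ℤ a 1ℤ as (mulFactors -1ℤ as f) u)) t ⟩
  mulFactor 1ℤ a (mulFactor -1ℤ a (mulFactors 1ℤ as (mulFactors -1ℤ as f))) t
    ≡⟨ mulFactor-conjugate a (mulFactors 1ℤ as (mulFactors -1ℤ as f)) t ⟩
  mulFactor -1ℤ (a ℕ.+ a) (mulFactors 1ℤ as (mulFactors -1ℤ as f)) t
    ≡⟨ mulFactor-cong -1ℤ (a ℕ.+ a) (mulFactors-conjugate as f) t ⟩
  mulFactors -1ℤ (map (λ a → a ℕ.+ a) (a ∷ as)) f t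
    ∎
  where open ≡-Reasoning

-- stretch f is the series f(x²).
stretch : Series → Series
stretch f zero          = f zero
stretch f (suc zero)    = 0ℤ
stretch f (suc (suc t)) = stretch (f ∘ suc) t

stretch-double : ∀ f h → stretch f (2 ℕ.* h) ≡ f h
stretch-double f zero    = refl
stretch-double f (suc h) rewrite ℕP.*-suc 2 h = stretch-double (f ∘ suc) h

stretch-odd : ∀ f h → stretch f (2 ℕ.* h ℕ.+ 1) ≡ 0ℤ
stretch-odd f zero    = refl
stretch-odd f (suc h) rewrite ℕP.+-suc h (h ℕ.+ 0) = stretch-odd (f ∘ suc) h

stretch-linear : ∀ f c g t → stretch (λ u → f u + c * g u) t ≡ stretch f t + c * stretch g t
stretch-linear f c g zero          = refl
stretch-linear f c g (suc zero)    = sym (cong (_+_ 0ℤ) (ℤP.*-zeroʳ c))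
stretch-linear f c g (suc (suc t)) = stretch-linear (f ∘ suc) c (g ∘ suc) t

shift-stretch : ∀ a f t → shift (a ℕ.+ a) (stretch f) t ≡ stretch (shift a f) t
shift-stretch zero    f t = refl
shift-stretch (suc a) f t rewrite ℕP.+-suc a a = shifted t
  where
  shifted : ∀ t → shift (suc (suc (a ℕ.+ a))) (stretch f) t ≡ stretch (shift (suc a) f) t
  shifted zero          = refl
  shifted (suc zero)    = refl
  shifted (suc (suc t)) = shift-stretch a f t

stretch-one : stretch one ≗ one
stretch-one zero          = refl
stretch-one (suc zero)    = refl
stretch-one (suc (suc t)) = stretch-zero t
  where
  stretch-zero : ∀ t → stretch (λ _ → 0ℤ) t ≡ 0ℤ
  stretch-zero zero          = refl
  stretch-zero (suc zero)    = refl
  stretch-zero (suc (suc t)) = stretch-zero t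

mulFactor-stretch : ∀ c a f → mulFactor c (a ℕ.+ a) (stretch f) ≗ stretch (mulFactor c a f)
mulFactor-stretch c a f t =
  trans (cong (λ x → stretch f t + c * x) (shift-stretch a f t)) (sym (stretch-linear f c (shift a f) t))

mulFactors-stretch : ∀ c as f →
  mulFactors c (map (λ a → a ℕ.+ a) as) (stretch f) ≗ stretch (mulFactors c as f)
mulFactors-stretch c []       f t = refl
mulFactors-stretch c (a ∷ as) f t =
  trans (mulFactor-cong c (a ℕ.+ a) (mulFactors-stretch c as f) t) (mulFactor-stretch c a (mulFactors c as f) t)

⋆-conjugate : ∀ as → mulFactors -1ℤ as one ⋆ mulFactors 1ℤ as one ≗ stretch (mulFactors -1ℤ as one)
⋆-conjugate as n = begin
  (E ⋆ mulFactors 1ℤ as one) n                ≡⟨ ⋆-mulFactors E 1ℤ as one n ⟩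
  mulFactors 1ℤ as (E ⋆ one) n                ≡⟨ mulFactors-cong 1ℤ as (⋆-one E) n ⟩
  mulFactors 1ℤ as E n                        ≡⟨ mulFactors-conjugate as one n ⟩
  mulFactors -1ℤ doubled one n                ≡⟨ mulFactors-cong -1ℤ doubled stretch-one n ⟨
  mulFactors -1ℤ doubled (stretch one) n      ≡⟨ mulFactors-stretch -1ℤ as one n ⟩
  stretch E n                                 ∎
  where
  open ≡-Reasoning
  E : Series
  E = mulFactors -1ℤ as one
  doubled : List ℕ
  doubled = map (λ a → a ℕ.+ a) as


-- Distinct partitions by the greatest common divisor of their parts

count : {A : Set} → (A → Bool) → List A → ℤ
count p []       = 0ℤ
count p (x ∷ xs) = ⟦ p x ⟧ + count p xs

count-++ : ∀ {A : Set} (p : A → Bool) xs ys → count p (xs ++ ys) ≡ count p xs + count p ys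
count-++ p []       ys = sym (ℤP.+-identityˡ _)
count-++ p (x ∷ xs) ys = trans (cong (_+_ ⟦ p x ⟧) (count-++ p xs ys)) (sym (ℤP.+-assoc ⟦ p x ⟧ _ _))

count-map : ∀ {A B : Set} (p : B → Bool) (f : A → B) xs → count p (map f xs) ≡ count (p ∘ f) xs
count-map p f []       = refl
count-map p f (x ∷ xs) = cong (_+_ ⟦ p (f x) ⟧) (count-map p f xs)

count-cong : ∀ {A : Set} {p q : A → Bool} xs → (∀ x → p x ≡ q x) → count p xs ≡ count q xs
count-cong []       p≗q = refl
count-cong (x ∷ xs) p≗q = cong₂ _+_ (cong ⟦_⟧ (p≗q x)) (count-cong xs p≗q)

count-none : ∀ {A : Set} (p : A → Bool) xs → (∀ x → ¬ T (p x)) → count p xs ≡ 0ℤ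
count-none p []       none = refl
count-none p (x ∷ xs) none with p x | none x
... | true  | ¬px = ⊥-elim (¬px _)
... | false | _   = trans (ℤP.+-identityˡ (count p xs)) (count-none p xs none)

length-filter : ∀ {A : Set} {P : A → Set} (P? : Decidable P) xs →
  + length (filter P? xs) ≡ count (does ∘ P?) xs
length-filter P? []       = refl
length-filter P? (x ∷ xs) with does (P? x)
... | true  = trans (ℤP.pos-+ 1 (length (filter P? xs))) (cong (_+_ 1ℤ) (length-filter P? xs))
... | false = trans (length-filter P? xs) (sym (ℤP.+-identityˡ _))

count-sublists : ∀ (p : List ℕ → Bool) x xs →
  count p (sublists (x ∷ xs)) ≡ count (p ∘ (x ∷_)) (sublists xs) + count p (sublists xs)
count-sublists p x xs = trans (count-++ p (map (x ∷_) (sublists xs)) (sublists xs))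
                              (cong (_+ count p (sublists xs)) (count-map p (x ∷_) (sublists xs)))

mulFactors-count : ∀ as N → mulFactors 1ℤ as one N ≡ count (λ s → does (sum s ≟ N)) (sublists as)
mulFactors-count []       zero    = refl
mulFactors-count []       (suc N) = refl
mulFactors-count (a ∷ as) N = begin
  mulFactors 1ℤ as one N + 1ℤ * shift a (mulFactors 1ℤ as one) N
    ≡⟨ cong₂ _+_ (mulFactors-count as N) (trans (ℤP.*-identityˡ _) (shifted N)) ⟩
  count (sumIs N) (sublists as) + count (sumIs N ∘ (a ∷_)) (sublists as)
    ≡⟨ ℤP.+-comm (count (sumIs N) (sublists as)) _ ⟩
  count (sumIs N ∘ (a ∷_)) (sublists as) + count (sumIs N) (sublists as)
    ≡⟨ count-sublists (sumIs N) a as ⟨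
  count (sumIs N) (sublists (a ∷ as))
    ∎
  where
  open ≡-Reasoning
  sumIs : ℕ → List ℕ → Bool
  sumIs N s = does (sum s ≟ N)
  shifted : ∀ N → shift a (mulFactors 1ℤ as one) N ≡ count (sumIs N ∘ (a ∷_)) (sublists as)
  shifted N with N <? a
  ... | yes N<a = trans (shift-< a _ N N<a) (sym (count-none _ (sublists as)
          (λ s a+s≡N → ℕP.<⇒≱ N<a (ℕP.≤-trans (ℕP.m≤m+n a (sum s))
                                               (ℕP.≤-reflexive (ℕP.≡ᵇ⇒≡ _ _ a+s≡N))))))
  ... | no N≮a with ℕP.m≤n⇒∃[o]m+o≡n (ℕP.≮⇒≥ N≮a)
  ... | v , refl = trans (shift-+ˡ a _ v) (trans (mulFactors-count as v)
          (count-cong (sublists as) (λ s → does-⇔ (mk⇔ (cong (a ℕ.+_)) (ℕP.+-cancelˡ-≡ a _ _))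
                                                   (sum s ≟ v) (a ℕ.+ sum s ≟ a ℕ.+ v))))

count-sublists-map : ∀ (f : ℕ → ℕ) xs (p : List ℕ → Bool) →
  count p (sublists (map f xs)) ≡ count (p ∘ map f) (sublists xs)
count-sublists-map f []       p = refl
count-sublists-map f (x ∷ xs) p = begin
  count p (sublists (f x ∷ map f xs))
    ≡⟨ count-sublists p (f x) (map f xs) ⟩
  count (p ∘ (f x ∷_)) (sublists (map f xs)) + count p (sublists (map f xs))
    ≡⟨ cong₂ _+_ (count-sublists-map f xs (p ∘ (f x ∷_))) (count-sublists-map f xs p) ⟩
  count (p ∘ map f ∘ (x ∷_)) (sublists xs) + count (p ∘ map f) (sublists xs)
    ≡⟨ count-sublists (p ∘ map f) x xs ⟨
  count (p ∘ map f) (sublists (x ∷ xs))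
    ∎
  where open ≡-Reasoning

count-sublists-filter : ∀ {Q : ℕ → Set} (Q? : Decidable Q) (p : List ℕ → Bool) xs →
  (∀ s → T (p s) → All Q s) → count p (sublists xs) ≡ count p (sublists (filter Q? xs))
count-sublists-filter Q? p []       p⇒Q = refl
count-sublists-filter Q? p (x ∷ xs) p⇒Q with Q? x
... | yes _ = trans (count-sublists p x xs)
  (trans (cong₂ _+_ (count-sublists-filter Q? (p ∘ (x ∷_)) xs (λ s → All.tail ∘ p⇒Q (x ∷ s)))
                    (count-sublists-filter Q? p xs p⇒Q))
         (sym (count-sublists p x (filter Q? xs))))
... | no ¬Qx = trans (count-sublists p x xs)
  (trans (cong₂ _+_ (count-none (p ∘ (x ∷_)) (sublists xs) (λ s → ¬Qx ∘ All.head ∘ p⇒Q (x ∷ s)))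
                    (count-sublists-filter Q? p xs p⇒Q))
         (ℤP.+-identityˡ _))


range-++ : ∀ a k l → range a (k ℕ.+ l) ≡ range a k ++ range (a ℕ.+ k) l
range-++ a zero    l = cong (λ b → range b l) (sym (ℕP.+-identityʳ a))
range-++ a (suc k) l = cong (suc a ∷_) (trans (range-++ (suc a) k l)
                                               (cong (λ b → range (suc a) k ++ range b l) (sym (ℕP.+-suc a k))))

range-> : ∀ a k → All (a <_) (range a k)
range-> a zero    = []
range-> a (suc k) = ℕP.≤-refl ∷ All.map (ℕP.<-trans (ℕP.n<1+n a)) (range-> (suc a) k)

range-≤ : ∀ a k → All (_≤ a ℕ.+ k) (range a k)
range-≤ a zero    = []
range-≤ a (suc k) =
  ℕP.≤-trans (s≤s (ℕP.m≤m+n a k)) 1+a+k≤a+1+k ∷ All.map (λ x≤ → ℕP.≤-trans x≤ 1+a+k≤a+1+k) (range-≤ (suc a) k)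
  where
  1+a+k≤a+1+k : suc a ℕ.+ k ≤ a ℕ.+ suc k
  1+a+k≤a+1+k = ℕP.≤-reflexive (sym (ℕP.+-suc a k))

applyUpTo-range : ∀ a k (f : ℕ → ℕ) → (∀ i → f i ≡ suc (a ℕ.+ i)) → applyUpTo f k ≡ range a k
applyUpTo-range a zero    f f≗ = refl
applyUpTo-range a (suc k) f f≗ = cong₂ _∷_ (trans (f≗ 0) (cong suc (ℕP.+-identityʳ a)))
  (applyUpTo-range (suc a) k (f ∘ suc) (λ i → trans (f≗ (suc i)) (cong suc (ℕP.+-suc a i))))

map-suc-upTo : ∀ m → map suc (upTo m) ≡ range 0 m
map-suc-upTo m = trans (LP.map-upTo suc m) (applyUpTo-range 0 m suc (λ _ → refl))

filter-≤-range : ∀ N n → N ≤ n → filter (_≤? N) (range 0 n) ≡ range 0 N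
filter-≤-range N n N≤n = begin
  filter (_≤? N) (range 0 n)
    ≡⟨ cong (filter (_≤? N) ∘ range 0) (ℕP.m+[n∸m]≡n N≤n) ⟨
  filter (_≤? N) (range 0 (N ℕ.+ (n ∸ N)))
    ≡⟨ cong (filter (_≤? N)) (range-++ 0 N (n ∸ N)) ⟩
  filter (_≤? N) (range 0 N ++ range N (n ∸ N))
    ≡⟨ LP.filter-++ (_≤? N) (range 0 N) (range N (n ∸ N)) ⟩
  filter (_≤? N) (range 0 N) ++ filter (_≤? N) (range N (n ∸ N))
    ≡⟨ cong₂ _++_ (LP.filter-all (_≤? N) (range-≤ 0 N))
                  (LP.filter-none (_≤? N) (All.map ℕP.<⇒≱ (range-> N (n ∸ N)))) ⟩
  range 0 N ++ []
    ≡⟨ LP.++-identityʳ (range 0 N) ⟩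
  range 0 N
    ∎
  where open ≡-Reasoning

∤-between : ∀ j m x → j ℕ.* m < x → x < j ℕ.* suc m → ¬ (j ∣ x)
∤-between j m x jm<x x<j[1+m] (divides q refl) = ℕP.<⇒≱ x<j[1+m] (begin
  j ℕ.* suc m   ≡⟨ ℕP.*-comm j (suc m) ⟩
  suc m ℕ.* j   ≤⟨ ℕP.*-monoˡ-≤ j (ℕP.*-cancelʳ-< j m q (subst (_< q ℕ.* j) (ℕP.*-comm j m) jm<x)) ⟩
  q ℕ.* j       ∎)
  where open ℕP.≤-Reasoning

filter-∣-block : ∀ j′ m → let j = suc j′ in filter (j ∣?_) (range (j ℕ.* m) j) ≡ [ j ℕ.* suc m ]
filter-∣-block j′ m = begin
  filter (j ∣?_) (range (j ℕ.* m) (suc j′))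
    ≡⟨ cong (filter (j ∣?_)) (range-∷ʳ (j ℕ.* m) j′) ⟩
  filter (j ∣?_) (range (j ℕ.* m) j′ ++ [ suc (j ℕ.* m ℕ.+ j′) ])
    ≡⟨ LP.filter-++ (j ∣?_) (range (j ℕ.* m) j′) _ ⟩
  filter (j ∣?_) (range (j ℕ.* m) j′) ++ filter (j ∣?_) [ suc (j ℕ.* m ℕ.+ j′) ]
    ≡⟨ cong₂ _++_ (LP.filter-none (j ∣?_)
                                  (All.zipWith between (range-> (j ℕ.* m) j′ , range-≤ (j ℕ.* m) j′)))
                  (LP.filter-accept (j ∣?_) (divides (suc m) (trans last (ℕP.*-comm j (suc m))))) ⟩
  [ suc (j ℕ.* m ℕ.+ j′) ]
    ≡⟨ cong [_] last ⟩
  [ j ℕ.* suc m ]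
    ∎
  where
  open ≡-Reasoning
  j : ℕ
  j = suc j′
  last : suc (j ℕ.* m ℕ.+ j′) ≡ j ℕ.* suc m
  last = expand j′ m
    where
    expand : ∀ j′ m → suc (suc j′ ℕ.* m ℕ.+ j′) ≡ suc j′ ℕ.* suc m
    expand = ℕSolver.solve-∀
  between : ∀ {x} → j ℕ.* m < x × x ≤ j ℕ.* m ℕ.+ j′ → ¬ (j ∣ x)
  between (lo , hi) = ∤-between j m _ lo (ℕP.≤-<-trans hi (ℕP.≤-reflexive last))

filter-∣-range : ∀ j′ m → let j = suc j′ in
  filter (j ∣?_) (range 0 (j ℕ.* m)) ≡ map (j ℕ.*_) (range 0 m)
filter-∣-range j′ zero    rewrite ℕP.*-zeroʳ j′ = refl
filter-∣-range j′ (suc m) = begin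
  filter (j ∣?_) (range 0 (j ℕ.* suc m))
    ≡⟨ cong (filter (j ∣?_) ∘ range 0) (trans (ℕP.*-suc j m) (ℕP.+-comm j (j ℕ.* m))) ⟩
  filter (j ∣?_) (range 0 (j ℕ.* m ℕ.+ j))
    ≡⟨ cong (filter (j ∣?_)) (range-++ 0 (j ℕ.* m) j) ⟩
  filter (j ∣?_) (range 0 (j ℕ.* m) ++ range (j ℕ.* m) j)
    ≡⟨ LP.filter-++ (j ∣?_) (range 0 (j ℕ.* m)) _ ⟩
  filter (j ∣?_) (range 0 (j ℕ.* m)) ++ filter (j ∣?_) (range (j ℕ.* m) j)
    ≡⟨ cong₂ _++_ (filter-∣-range j′ m) (filter-∣-block j′ m) ⟩
  map (j ℕ.*_) (range 0 m) ++ map (j ℕ.*_) [ suc m ]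
    ≡⟨ LP.map-++ (j ℕ.*_) (range 0 m) [ suc m ] ⟨
  map (j ℕ.*_) (range 0 m ++ [ suc m ])
    ≡⟨ cong (map (j ℕ.*_)) (range-∷ʳ 0 m) ⟨
  map (j ℕ.*_) (range 0 (suc m))
    ∎
  where
  open ≡-Reasoning
  j : ℕ
  j = suc j′

All-≤-sum : ∀ s → All (_≤ sum s) s
All-≤-sum []      = []
All-≤-sum (x ∷ s) = ℕP.m≤m+n x (sum s) ∷ All.map (λ y≤ → ℕP.≤-trans y≤ (ℕP.m≤n+m (sum s) x)) (All-≤-sum s)

gcdList-∣ : ∀ s → All (gcdList s ∣_) s
gcdList-∣ []      = []
gcdList-∣ (x ∷ s) = gcd[m,n]∣m x (gcdList s) ∷ All.map (∣-trans (gcd[m,n]∣n x (gcdList s))) (gcdList-∣ s)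

All-∣-sum : ∀ {d} s → All (d ∣_) s → d ∣ sum s
All-∣-sum []      []         = divides 0 refl
All-∣-sum (x ∷ s) (d∣x ∷ d∣s) = ∣m∣n⇒∣m+n d∣x (All-∣-sum s d∣s)

gcdList∣sum : ∀ s → gcdList s ∣ sum s
gcdList∣sum s = All-∣-sum s (gcdList-∣ s)

sum-map-* : ∀ j s → sum (map (j ℕ.*_) s) ≡ j ℕ.* sum s
sum-map-* j []      = sym (ℕP.*-zeroʳ j)
sum-map-* j (x ∷ s) = trans (cong (j ℕ.* x ℕ.+_) (sum-map-* j s)) (sym (ℕP.*-distribˡ-+ j x (sum s)))

gcdList-map-* : ∀ j s → gcdList (map (j ℕ.*_) s) ≡ j ℕ.* gcdList s
gcdList-map-* j []      = sym (ℕP.*-zeroʳ j)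
gcdList-map-* j (x ∷ s) =
  trans (cong (gcd (j ℕ.* x)) (gcdList-map-* j s)) (sym (c*gcd[m,n]≡gcd[cm,cn] j x (gcdList s)))

hasSumGcd : ℕ → ℕ → List ℕ → Bool
hasSumGcd N g s = does (sum s ≟ N) ∧ does (gcdList s ≟ g)

hasSumGcd-sound : ∀ N g s → T (hasSumGcd N g s) → sum s ≡ N × gcdList s ≡ g
hasSumGcd-sound N g s p with Equivalence.to (T-∧ {does (sum s ≟ N)}) p
... | sum≡ , gcd≡ = ℕP.≡ᵇ⇒≡ (sum s) N sum≡ , ℕP.≡ᵇ⇒≡ (gcdList s) g gcd≡

hasSumGcd-scale : ∀ j′ m s → let j = suc j′ in
  hasSumGcd (j ℕ.* m) j (map (j ℕ.*_) s) ≡ hasSumGcd m 1 s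
hasSumGcd-scale j′ m s = cong₂ _∧_
  (does-⇔ (mk⇔ (λ eq → ℕP.*-cancelˡ-≡ (sum s) m j (trans (sym (sum-map-* j s)) eq))
               (λ eq → trans (sum-map-* j s) (cong (j ℕ.*_) eq)))
          (sum (map (j ℕ.*_) s) ≟ j ℕ.* m) (sum s ≟ m))
  (does-⇔ (mk⇔ (λ eq → ℕP.*-cancelˡ-≡ (gcdList s) 1 j
                          (trans (sym (gcdList-map-* j s)) (trans eq (sym (ℕP.*-identityʳ j)))))
               (λ eq → trans (gcdList-map-* j s) (trans (cong (j ℕ.*_) eq) (ℕP.*-identityʳ j))))
          (gcdList (map (j ℕ.*_) s) ≟ j) (gcdList s ≟ 1))
  where
  j : ℕ
  j = suc j′

qψ-count : ∀ m → + qψ m ≡ count (hasSumGcd m 1) (sublists (range 0 m))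
qψ-count m = trans (length-filter (λ s → (sum s ≟ m) ×-dec (gcdList s ≟ 1)) (sublists (map suc (upTo m))))
                   (cong (count (hasSumGcd m 1) ∘ sublists) (map-suc-upTo m))

-- A distinct partition of j m with gcd j has all its parts among j, 2j, …, jm, and dividing
-- them by j is a bijection onto the partitions counted by q_ψ(m).
count-hasSumGcd : ∀ j′ m n → let j = suc j′ in j ℕ.* m ≤ n →
  count (hasSumGcd (j ℕ.* m) j) (sublists (range 0 n)) ≡ + qψ m
count-hasSumGcd j′ m n jm≤n = begin
  count p (sublists (range 0 n))
    ≡⟨ count-sublists-filter (_≤? N) p (range 0 n) parts-≤ ⟩
  count p (sublists (filter (_≤? N) (range 0 n)))
    ≡⟨ cong (count p ∘ sublists) (filter-≤-range N n jm≤n) ⟩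
  count p (sublists (range 0 N))
    ≡⟨ count-sublists-filter (j ∣?_) p (range 0 N) parts-∣ ⟩
  count p (sublists (filter (j ∣?_) (range 0 N)))
    ≡⟨ cong (count p ∘ sublists) (filter-∣-range j′ m) ⟩
  count p (sublists (map (j ℕ.*_) (range 0 m)))
    ≡⟨ count-sublists-map (j ℕ.*_) (range 0 m) p ⟩
  count (p ∘ map (j ℕ.*_)) (sublists (range 0 m))
    ≡⟨ count-cong (sublists (range 0 m)) (hasSumGcd-scale j′ m) ⟩
  count (hasSumGcd m 1) (sublists (range 0 m))
    ≡⟨ qψ-count m ⟨
  + qψ m
    ∎
  where
  open ≡-Reasoning
  j N : ℕ
  j = suc j′
  N = j ℕ.* m
  p : List ℕ → Bool
  p = hasSumGcd N j
  parts-≤ : ∀ s → T (p s) → All (_≤ N) s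
  parts-≤ s ps = subst (λ n → All (_≤ n) s) (proj₁ (hasSumGcd-sound N j s ps)) (All-≤-sum s)
  parts-∣ : ∀ s → T (p s) → All (j ∣_) s
  parts-∣ s ps = subst (λ g → All (g ∣_) s) (proj₂ (hasSumGcd-sound N j s ps)) (gcdList-∣ s)

⟦hasSumGcd⟧ : ∀ N g s → sum s ≡ N → ⟦ hasSumGcd N g s ⟧ ≡ ⟦ does (gcdList s ≟ g) ⟧
⟦hasSumGcd⟧ N g s sum≡N = cong (λ b → ⟦ b ∧ does (gcdList s ≟ g) ⟧) (dec-true (sum s ≟ N) sum≡N)

gcdList-suc : ∀ s {N} → sum s ≡ suc N → ∃ λ d → gcdList s ≡ suc d
gcdList-suc s sum≡ with gcdList s | gcdList∣sum s
... | zero  | 0∣sum = ⊥-elim (ℕP.1+n≢0 (trans (sym sum≡) (0∣⇒≡0 0∣sum)))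
... | suc d | _     = d , refl

⟦sum≡⟧-by-gcd : ∀ N n s → suc N ≤ n →
  ⟦ does (sum s ≟ suc N) ⟧ ≡ ∑[ d < n ] ⟦ hasSumGcd (suc N) (suc d) s ⟧
⟦sum≡⟧-by-gcd N n s N<n with sum s ≟ suc N
... | no sum≢ = trans (cong ⟦_⟧ (dec-false (sum s ≟ suc N) sum≢))
  (sym (∑-zero n (λ d _ → cong (λ b → ⟦ b ∧ does (gcdList s ≟ suc d) ⟧)
                                (dec-false (sum s ≟ suc N) sum≢))))
... | yes sum≡ with gcdList-suc s sum≡
...   | d₀ , gcd≡ = trans (cong ⟦_⟧ (dec-true (sum s ≟ suc N) sum≡)) (sym (begin
  ∑[ d < n ] ⟦ hasSumGcd (suc N) (suc d) s ⟧   ≡⟨ ∑-single n d₀ _ d₀<n others ⟩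
  ⟦ hasSumGcd (suc N) (suc d₀) s ⟧             ≡⟨ ⟦hasSumGcd⟧ (suc N) (suc d₀) s sum≡ ⟩
  ⟦ does (gcdList s ≟ suc d₀) ⟧               ≡⟨ cong ⟦_⟧ (dec-true (gcdList s ≟ suc d₀) gcd≡) ⟩
  1ℤ                                          ∎))
  where
  open ≡-Reasoning
  d₀<n : d₀ < n
  d₀<n = ℕP.≤-trans (∣⇒≤ (subst₂ _∣_ gcd≡ sum≡ (gcdList∣sum s))) N<n
  others : ∀ d → d < n → d ≢ d₀ → ⟦ hasSumGcd (suc N) (suc d) s ⟧ ≡ 0ℤ
  others d _ d≢d₀ = trans (⟦hasSumGcd⟧ (suc N) (suc d) s sum≡)
    (cong ⟦_⟧ (dec-false (gcdList s ≟ suc d)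
                         (λ gcd≡1+d → d≢d₀ (ℕP.suc-injective (trans (sym gcd≡1+d) gcd≡)))))

count-by-gcd : ∀ N n X → suc N ≤ n →
  count (λ s → does (sum s ≟ suc N)) X ≡ ∑[ d < n ] count (hasSumGcd (suc N) (suc d)) X
count-by-gcd N n []      _   = sym (∑-zero n (λ _ _ → refl))
count-by-gcd N n (s ∷ X) N<n = trans (cong₂ _+_ (⟦sum≡⟧-by-gcd N n s N<n) (count-by-gcd N n X N<n))
  (sym (∑-distrib-+ n (λ d → ⟦ hasSumGcd (suc N) (suc d) s ⟧)
                      (λ d → count (hasSumGcd (suc N) (suc d)) X)))

count-hasSumGcd-∑ : ∀ n N j′ → suc N ≤ n →
  count (hasSumGcd (suc N) (suc j′)) (sublists (range 0 n))
    ≡ ∑[ i < n ] + qψ (suc i) * ⟦ does (suc j′ ℕ.* suc i ≟ suc N) ⟧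
count-hasSumGcd-∑ n N j′ N<n with suc j′ ∣? suc N
... | no j∤N = trans
  (count-none _ (sublists (range 0 n))
     (λ s ps → let sum≡ , gcd≡ = hasSumGcd-sound (suc N) (suc j′) s ps
               in j∤N (subst₂ _∣_ gcd≡ sum≡ (gcdList∣sum s))))
  (sym (∑-zero n (λ i _ → trans (cong (λ b → + qψ (suc i) * ⟦ b ⟧)
          (dec-false (suc j′ ℕ.* suc i ≟ suc N) (λ eq → j∤N (subst (suc j′ ∣_) eq (m∣m*n (suc i))))))
          (ℤP.*-zeroʳ (+ qψ (suc i))))))
... | yes (divides zero ())
... | yes (divides (suc i₀) N≡) = begin
  count (hasSumGcd (suc N) (suc j′)) (sublists (range 0 n))
    ≡⟨ cong (λ N → count (hasSumGcd N (suc j′)) (sublists (range 0 n))) N≡j[1+i₀] ⟩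
  count (hasSumGcd (suc j′ ℕ.* suc i₀) (suc j′)) (sublists (range 0 n))
    ≡⟨ count-hasSumGcd j′ (suc i₀) n (subst (_≤ n) N≡j[1+i₀] N<n) ⟩
  + qψ (suc i₀)
    ≡⟨ ℤP.*-identityʳ (+ qψ (suc i₀)) ⟨
  + qψ (suc i₀) * 1ℤ
    ≡⟨ cong (λ b → + qψ (suc i₀) * ⟦ b ⟧) (dec-true (suc j′ ℕ.* suc i₀ ≟ suc N) (sym N≡j[1+i₀])) ⟨
  + qψ (suc i₀) * ⟦ does (suc j′ ℕ.* suc i₀ ≟ suc N) ⟧
    ≡⟨ ∑-single n i₀ _ i₀<n others ⟨
  ∑[ i < n ] + qψ (suc i) * ⟦ does (suc j′ ℕ.* suc i ≟ suc N) ⟧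
    ∎
  where
  open ≡-Reasoning
  N≡j[1+i₀] : suc N ≡ suc j′ ℕ.* suc i₀
  N≡j[1+i₀] = trans N≡ (ℕP.*-comm (suc i₀) (suc j′))
  i₀<n : i₀ < n
  i₀<n = ℕP.≤-trans (ℕP.≤-trans (ℕP.m≤n*m (suc i₀) (suc j′)) (ℕP.≤-reflexive (sym N≡j[1+i₀]))) N<n
  others : ∀ i → i < n → i ≢ i₀ → + qψ (suc i) * ⟦ does (suc j′ ℕ.* suc i ≟ suc N) ⟧ ≡ 0ℤ
  others i _ i≢i₀ = trans (cong (λ b → + qψ (suc i) * ⟦ b ⟧)
      (dec-false (suc j′ ℕ.* suc i ≟ suc N)
                 (λ eq → i≢i₀ (ℕP.suc-injective (ℕP.*-cancelˡ-≡ (suc i) (suc i₀) (suc j′) (trans eq N≡j[1+i₀]))))))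
      (ℤP.*-zeroʳ (+ qψ (suc i)))

distinctProduct : ℕ → Series
distinctProduct n = mulFactors 1ℤ (range 0 n) one

distinctProduct-coefficient : ∀ n N → suc N ≤ n →
  distinctProduct n (suc N) ≡ ∑[ d < n ] ∑[ i < n ] + qψ (suc i) * ⟦ does (suc d ℕ.* suc i ≟ suc N) ⟧
distinctProduct-coefficient n N N<n = begin
  distinctProduct n (suc N)
    ≡⟨ mulFactors-count (range 0 n) (suc N) ⟩
  count (λ s → does (sum s ≟ suc N)) (sublists (range 0 n))
    ≡⟨ count-by-gcd N n (sublists (range 0 n)) N<n ⟩
  ∑[ d < n ] count (hasSumGcd (suc N) (suc d)) (sublists (range 0 n))
    ≡⟨ ∑-cong n (λ d _ → count-hasSumGcd-∑ n N d N<n) ⟩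
  ∑[ d < n ] ∑[ i < n ] + qψ (suc i) * ⟦ does (suc d ℕ.* suc i ≟ suc N) ⟧
    ∎
  where open ≡-Reasoning


-- Comparing coefficients of xⁿ

foldr-applyUpTo : ∀ n (f : ℕ → ℤ) → foldr _+_ 0ℤ (applyUpTo f n) ≡ ∑< n f
foldr-applyUpTo zero    f = refl
foldr-applyUpTo (suc n) f = trans (cong (_+_ (f 0)) (foldr-applyUpTo n (f ∘ suc))) (sym (∑-sucˡ n f))

foldr-map-upTo : ∀ n (f : ℕ → ℤ) → foldr _+_ 0ℤ (map f (upTo n)) ≡ ∑< n f
foldr-map-upTo n f = trans (cong (foldr _+_ 0ℤ) (LP.map-upTo f n)) (foldr-applyUpTo n f)

ω-< : ∀ n M → n < M → ω (+ n - + M) ≡ 0ℤ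
ω-< n (suc M) n≤M rewrite ℤP.m-n≡m⊖n n (suc M) | ℤP.⊖-< n≤M | ℕP.+-∸-assoc 1 n≤M = refl

ω-≥ : ∀ n M → M ≤ n → ω (+ n - + M) ≡ ωℕ (n ∸ M)
ω-≥ n M M≤n = cong ω (trans (ℤP.m-n≡m⊖n n M) (ℤP.⊖-≥ M≤n))

mulFactors-range-0 : ∀ c a k (f : Series) → mulFactors c (range a k) f 0 ≡ f 0
mulFactors-range-0 c a zero    f = refl
mulFactors-range-0 c a (suc k) f = begin
  P 0 + c * 0ℤ   ≡⟨ cong (_+_ (P 0)) (ℤP.*-zeroʳ c) ⟩
  P 0 + 0ℤ       ≡⟨ ℤP.+-identityʳ (P 0) ⟩
  P 0            ≡⟨ mulFactors-range-0 c (suc a) k f ⟩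
  f 0            ∎
  where
  open ≡-Reasoning
  P : Series
  P = mulFactors c (range (suc a) k) f

innerSum-∑ : ∀ n i → i < n →
  innerSum (suc i) (n ∸ suc i) ≡ ∑[ d < n ] ω (+ n - + (suc d ℕ.* suc i))
innerSum-∑ n i i<n with ℕP.m≤n⇒∃[o]m+o≡n i<n
... | r , refl = begin
  innerSum m (m ℕ.+ r ∸ m)
    ≡⟨ cong (innerSum m) (ℕP.m+n∸m≡n m r) ⟩
  innerSum m r
    ≡⟨ foldr-map-upTo (suc r) (λ j → ω (+ r - + (j ℕ.* m))) ⟩
  ∑[ j < suc r ] ω (+ r - + (j ℕ.* m))
    ≡⟨ ∑-cong (suc r) (λ j _ → cong ω (shifted j)) ⟩
  ∑[ j < suc r ] ω (+ (m ℕ.+ r) - + (suc j ℕ.* m))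
    ≡⟨ ∑-truncate (suc r) i _ (λ j _ → ω-< (m ℕ.+ r) _ (beyond j)) ⟨
  ∑[ j < suc r ℕ.+ i ] ω (+ (m ℕ.+ r) - + (suc j ℕ.* m))
    ≡⟨ cong (λ l → ∑[ j < l ] ω (+ (m ℕ.+ r) - + (suc j ℕ.* m))) (cong suc (ℕP.+-comm r i)) ⟩
  ∑[ j < m ℕ.+ r ] ω (+ (m ℕ.+ r) - + (suc j ℕ.* m))
    ∎
  where
  open ≡-Reasoning
  m : ℕ
  m = suc i
  shifted : ∀ j → + r - + (j ℕ.* m) ≡ + (m ℕ.+ r) - + (suc j ℕ.* m)
  shifted j = trans (cancel (+ m) (+ r) (+ (j ℕ.* m)))
                    (sym (cong₂ _-_ (ℤP.pos-+ m r) (ℤP.pos-+ m (j ℕ.* m))))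
    where
    cancel : ∀ a b c → b - c ≡ (a + b) - (a + c)
    cancel = solve-∀
  beyond : ∀ j → m ℕ.+ r < suc (suc r ℕ.+ j) ℕ.* m
  beyond j = ℕP.+-monoʳ-< m
    (ℕP.<-≤-trans (ℕP.n<1+n r) (ℕP.≤-trans (ℕP.m≤m+n (suc r) j) (ℕP.m≤m*n (suc r ℕ.+ j) m)))

∑-ω-⟦≟⟧ : ∀ n a → ∑[ k < n ] ωℕ (n ∸ suc k) * ⟦ does (suc a ≟ suc k) ⟧ ≡ ω (+ n - + suc a)
∑-ω-⟦≟⟧ n a with a <? n
... | yes a<n = begin
  ∑[ k < n ] ωℕ (n ∸ suc k) * ⟦ does (suc a ≟ suc k) ⟧
    ≡⟨ ∑-single n a _ a<n others ⟩
  ωℕ (n ∸ suc a) * ⟦ does (suc a ≟ suc a) ⟧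
    ≡⟨ cong (λ b → ωℕ (n ∸ suc a) * ⟦ b ⟧) (dec-true (suc a ≟ suc a) refl) ⟩
  ωℕ (n ∸ suc a) * 1ℤ
    ≡⟨ ℤP.*-identityʳ _ ⟩
  ωℕ (n ∸ suc a)
    ≡⟨ ω-≥ n (suc a) a<n ⟨
  ω (+ n - + suc a)
    ∎
  where
  open ≡-Reasoning
  others : ∀ k → k < n → k ≢ a → ωℕ (n ∸ suc k) * ⟦ does (suc a ≟ suc k) ⟧ ≡ 0ℤ
  others k _ k≢a = trans (cong (λ b → ωℕ (n ∸ suc k) * ⟦ b ⟧)
                               (dec-false (suc a ≟ suc k) (k≢a ∘ sym ∘ ℕP.suc-injective)))
                         (ℤP.*-zeroʳ (ωℕ (n ∸ suc k)))
... | no a≮n = trans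
  (∑-zero n (λ k k<n → trans (cong (λ b → ωℕ (n ∸ suc k) * ⟦ b ⟧)
                                   (dec-false (suc a ≟ suc k)
                                      (λ eq → a≮n (ℕP.≤-<-trans (ℕP.≤-reflexive (ℕP.suc-injective eq)) k<n))))
                             (ℤP.*-zeroʳ (ωℕ (n ∸ suc k)))))
  (sym (ω-< n (suc a) (s≤s (ℕP.≮⇒≥ a≮n))))

∑-rearrange : ∀ n (w g : ℕ → ℤ) (e : ℕ → ℕ → ℕ → ℤ) →
  ∑[ k < n ] w k * (∑[ d < n ] ∑[ i < n ] g i * e d i k)
    ≡ ∑[ i < n ] g i * (∑[ d < n ] ∑[ k < n ] w k * e d i k)
∑-rearrange n w g e = begin
  ∑[ k < n ] w k * (∑[ d < n ] ∑[ i < n ] g i * e d i k)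
    ≡⟨ ∑-cong n (λ k _ → trans (sym (∑-*ˡ n (w k) _))
                               (∑-cong n (λ d _ → sym (∑-*ˡ n (w k) (λ i → g i * e d i k))))) ⟩
  ∑[ k < n ] ∑[ d < n ] ∑[ i < n ] w k * (g i * e d i k)
    ≡⟨ ∑-cong n (λ k _ → ∑-swap n n (λ d i → w k * (g i * e d i k))) ⟩
  ∑[ k < n ] ∑[ i < n ] ∑[ d < n ] w k * (g i * e d i k)
    ≡⟨ ∑-swap n n (λ k i → ∑[ d < n ] w k * (g i * e d i k)) ⟩
  ∑[ i < n ] ∑[ k < n ] ∑[ d < n ] w k * (g i * e d i k)
    ≡⟨ ∑-cong n (λ i _ → ∑-swap n n (λ k d → w k * (g i * e d i k))) ⟩
  ∑[ i < n ] ∑[ d < n ] ∑[ k < n ] w k * (g i * e d i k)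
    ≡⟨ ∑-cong n (λ i _ → ∑-cong n (λ d _ → ∑-cong n (λ k _ → exchange (w k) (g i) (e d i k)))) ⟩
  ∑[ i < n ] ∑[ d < n ] ∑[ k < n ] g i * (w k * e d i k)
    ≡⟨ ∑-cong n (λ i _ → trans (∑-cong n (λ d _ → ∑-*ˡ n (g i) (λ k → w k * e d i k)))
                               (∑-*ˡ n (g i) _)) ⟩
  ∑[ i < n ] g i * (∑[ d < n ] ∑[ k < n ] w k * e d i k)
    ∎
  where
  open ≡-Reasoning
  exchange : ∀ a b c → a * (b * c) ≡ b * (a * c)
  exchange = solve-∀

lhs-∑ : ∀ n → lhs n ≡ ∑[ k < n ] ωℕ (n ∸ suc k) * distinctProduct n (suc k)
lhs-∑ n = begin
  lhs n
    ≡⟨ foldr-map-upTo n (λ i → q i * innerSum (suc i) (n ∸ suc i)) ⟩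
  ∑[ i < n ] q i * innerSum (suc i) (n ∸ suc i)
    ≡⟨ ∑-cong n (λ i i<n → cong (q i *_) (trans (innerSum-∑ n i i<n)
                                                (∑-cong n (λ d _ → sym (∑-ω-⟦≟⟧ n (i ℕ.+ d ℕ.* suc i)))))) ⟩
  ∑[ i < n ] q i * (∑[ d < n ] ∑[ k < n ] W k * δ d i k)
    ≡⟨ ∑-rearrange n W q δ ⟨
  ∑[ k < n ] W k * (∑[ d < n ] ∑[ i < n ] q i * δ d i k)
    ≡⟨ ∑-cong n (λ k k<n → cong (W k *_) (sym (distinctProduct-coefficient n k k<n))) ⟩
  ∑[ k < n ] W k * distinctProduct n (suc k)
    ∎
  where
  open ≡-Reasoning
  q : ℕ → ℤ
  q i = + qψ (suc i)
  W : ℕ → ℤ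
  W k = ωℕ (n ∸ suc k)
  δ : ℕ → ℕ → ℕ → ℤ
  δ d i k = ⟦ does (suc d ℕ.* suc i ≟ suc k) ⟧

stretch-eulerProduct : ∀ n → stretch (eulerProduct n) n ≡ ωℕ n + lhs n
stretch-eulerProduct n = begin
  stretch (eulerProduct n) n
    ≡⟨ ⋆-conjugate (range 0 n) n ⟨
  (eulerProduct n ⋆ distinctProduct n) n
    ≡⟨ ∑-sucˡ n (λ k → eulerProduct n (n ∸ k) * distinctProduct n k) ⟩
  eulerProduct n n * distinctProduct n 0
    + (∑[ k < n ] eulerProduct n (n ∸ suc k) * distinctProduct n (suc k))
    ≡⟨ cong₂ _+_ (cong₂ _*_ (eulerProduct-ω n n ℕP.≤-refl) (mulFactors-range-0 1ℤ 0 n one))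
                 (∑-cong n (λ k _ → cong (_* distinctProduct n (suc k))
                                         (eulerProduct-ω n (n ∸ suc k) (ℕP.m∸n≤m n (suc k))))) ⟩
  ωℕ n * 1ℤ + (∑[ k < n ] ωℕ (n ∸ suc k) * distinctProduct n (suc k))
    ≡⟨ cong₂ _+_ (ℤP.*-identityʳ (ωℕ n)) (sym (lhs-∑ n)) ⟩
  ωℕ n + lhs n
    ∎
  where open ≡-Reasoning

lhs-stretch : ∀ n → lhs n ≡ - ωℕ n + stretch (eulerProduct n) n
lhs-stretch n = trans (cancel (ωℕ n) (lhs n)) (cong (_+_ (- ωℕ n)) (sym (stretch-eulerProduct n)))
  where
  cancel : ∀ a b → b ≡ - a + (a + b)
  cancel = solve-∀

-- The identity also holds for n = 0.
mainTheorem13 : (n : ℕ) → 1 ≤ n →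
    ((h : ℕ) → n ≡ 2 ℕ.* h ℕ.+ 1 → lhs n ≡ ℤ.- ω (+ n))
    × ((h : ℕ) → n ≡ 2 ℕ.* h → lhs n ≡ ℤ.- ω (+ n) ℤ.+ ω (+ h))
mainTheorem13 n _ = odd , even
  where
  odd : (h : ℕ) → n ≡ 2 ℕ.* h ℕ.+ 1 → lhs n ≡ - ω (+ n)
  odd h refl = begin
    lhs n                                    ≡⟨ lhs-stretch n ⟩
    - ωℕ n + stretch (eulerProduct n) n      ≡⟨ cong (_+_ (- ωℕ n)) (stretch-odd (eulerProduct n) h) ⟩
    - ωℕ n + 0ℤ                              ≡⟨ ℤP.+-identityʳ (- ωℕ n) ⟩
    - ωℕ n                                   ∎
    where open ≡-Reasoning
  even : (h : ℕ) → n ≡ 2 ℕ.* h → lhs n ≡ - ω (+ n) + ω (+ h)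
  even h refl = begin
    lhs n                                    ≡⟨ lhs-stretch n ⟩
    - ωℕ n + stretch (eulerProduct n) n      ≡⟨ cong (_+_ (- ωℕ n)) (stretch-double (eulerProduct n) h) ⟩
    - ωℕ n + eulerProduct n h                ≡⟨ cong (_+_ (- ωℕ n)) (eulerProduct-ω n h (ℕP.m≤m+n h (h ℕ.+ 0))) ⟩
    - ωℕ n + ωℕ h                            ∎
    where open ≡-Reasoning
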